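{- Let $G$ be a graph, let $M$ be a matching of size $2$ in $G$, and let $C$ be a triangle in $G$ that is vertex-disjoint from $M$. If the number of edges of $G$ with one end in $V(M)$ and the other end in $V(C)$ is at least $9$, then the induced subgraph $G[V(M)\cup V(C)]$ contains two vertex-disjoint triangles.
   Context: All graphs are finite and simple. $G[S]$ denotes the subgraph induced by a vertex set $S$. -}

module Defs where

open import Data.Nat using (ℕ; zero; suc; _+_)
open import Data.Fin using (Fin)
open import Data.Bool using (Bool; true; false; if_then_else_)
open import Data.List using (List; []; _∷_; map; concatMap)
open import Data.Nat.ListAction using (sum)
open import Data.List.Membership.Propositional using (_∈_)
open import Data.List.Relation.Unary.All using (All)
open import Data.List.Relation.Unary.Unique.Propositional using (Unique)
open import Data.Product using (_×_)
open import Relation.Binary.PropositionalEquality using (_≡_)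

record Graph (n : ℕ) : Set where
  field
    adj    : Fin n → Fin n → Bool
    sym    : ∀ u v → adj u v ≡ adj v u
    irrefl : ∀ v → adj v v ≡ false

module _ {n : ℕ} (G : Graph n) where
  open Graph G

  Adj : Fin n → Fin n → Set
  Adj u v = adj u v ≡ true

  -- a triangle: three pairwise adjacent (hence distinct) vertices
  IsTriangle : Fin n → Fin n → Fin n → Set
  IsTriangle x y z = Adj x y × Adj y z × Adj x z

  IsMatching2 : Fin n → Fin n → Fin n → Fin n → Set
  IsMatching2 a₁ b₁ a₂ b₂ =
    Adj a₁ b₁ × Adj a₂ b₂ × Unique (a₁ ∷ b₁ ∷ a₂ ∷ b₂ ∷ [])

  -- number of edges of G with one end in A and the other end in B
  -- (for disjoint vertex lists A, B without repetitions)
  edgesBetween : List (Fin n) → List (Fin n) → ℕ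
  edgesBetween A B =
    sum (concatMap (λ u → map (λ v → if adj u v then 1 else 0) B) A)

  TwoDisjointTrianglesIn : List (Fin n) → Set
  TwoDisjointTrianglesIn S =
    Data.Product.∃ λ p → Data.Product.∃ λ q → Data.Product.∃ λ r →
    Data.Product.∃ λ s → Data.Product.∃ λ t → Data.Product.∃ λ u →
      All (_∈ S) (p ∷ q ∷ r ∷ s ∷ t ∷ u ∷ [])
      × Unique (p ∷ q ∷ r ∷ s ∷ t ∷ u ∷ [])
      × IsTriangle p q r × IsTriangle s t u

-- Let e and e′ be the numbers of edges from the two matching edges into the
-- triangle T; each is at most 6 and e + e′ ≥ 9.  An edge sending more than |T|
-- edges into T has a common neighbour in T, and one sending more than |T| + 1
-- has a common neighbour avoiding any prescribed vertex.  So if e, e′ ≥ 4 (and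
-- hence one of them is ≥ 5), the two edges extend to triangles through distinct
-- vertices of T.  Otherwise, say e′ ≤ 3, we get e = 6, so the first edge is
-- complete to T, while e′ ≥ 3 gives an end v of the second edge with two
-- neighbours p, q in T: the triangles are v p q and the first edge with the
-- third vertex of T.
module Submission where

open import Defs
open import Data.Nat using (ℕ; suc; _+_; _≤_; _<_; _≥_; _≤?_; z≤n; s≤s; s≤s⁻¹)
open import Data.Nat.Properties
  using (≤-refl; ≤-trans; ≤-reflexive; ≰⇒>; +-comm; +-assoc; +-identityʳ;
         +-mono-≤; +-monoˡ-≤; n≮n; +-cancelˡ-≤; +-suc; +-commutativeSemigroup)
open import Data.Nat.ListAction using (sum)
open import Data.Nat.ListAction.Properties using (sum-++)
open import Algebra.Properties.CommutativeSemigroup +-commutativeSemigroup using (interchange)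
open import Data.Fin using (Fin; _≟_)
open import Data.Bool using (true; false; if_then_else_)
open import Data.List using (List; []; _∷_; _++_; map; concatMap; length)
open import Data.List.Membership.Propositional using (_∈_)
open import Data.List.Membership.Propositional.Properties using (∈-++⁺ʳ; ∈-++⁻)
open import Data.List.Relation.Unary.Any using (here; there)
open import Data.List.Relation.Unary.All as All using (All; []; _∷_)
open import Data.List.Relation.Unary.All.Properties as All using ()
open import Data.List.Relation.Unary.AllPairs using ([]; _∷_)
open import Data.List.Relation.Unary.Unique.Propositional using (Unique)
open import Data.List.Relation.Unary.Unique.Propositional.Properties as Unique using ()
open import Data.List.Relation.Binary.Subset.Propositional using (_⊆_)
open import Data.List.Relation.Binary.Subset.Propositional.Properties
  using (⊆-refl; ⊆-trans; ∈-∷⁺ʳ; xs⊆xs++ys; xs⊆ys++xs)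
open import Data.List.Relation.Binary.Disjoint.Propositional using (Disjoint)
open import Data.List.Relation.Binary.Disjoint.Propositional.Properties as Disjoint using ()
open import Data.Product using (_×_; _,_; proj₁; proj₂; ∃-syntax)
open import Data.Sum using (_⊎_; inj₁; inj₂; [_,_])
open import Relation.Nullary using (yes; no; contradiction)
open import Relation.Binary.PropositionalEquality
  using (_≡_; _≢_; refl; sym; trans; cong; cong₂; subst; module ≡-Reasoning)

private variable
  A : Set
  xs ys xs′ ys′ zs : List A

k+l≤m+n∧m≤k⇒l≤n : ∀ {k l m n} → k + l ≤ m + n → m ≤ k → l ≤ n
k+l≤m+n∧m≤k⇒l≤n {k} {l} {m} {n} h m≤k =
  +-cancelˡ-≤ k l n (≤-trans h (+-monoˡ-≤ n m≤k))

pigeonhole : ∀ k {m n} → suc (k + k) ≤ m + n → suc k ≤ m ⊎ suc k ≤ n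
pigeonhole k {m} h with suc k ≤? m
... | yes k<m = inj₁ k<m
... | no  k≮m = inj₂ (k+l≤m+n∧m≤k⇒l≤n (≤-trans (≤-reflexive (+-suc k k)) h)
                                       (s≤s⁻¹ (≰⇒> k≮m)))

Unique[xs++ys]⇒Disjoint : ∀ (xs : List A) → Unique (xs ++ ys) → Disjoint xs ys
Unique[xs++ys]⇒Disjoint (x ∷ xs) (x∉ ∷ _) (here refl , v∈ys) =
  All.lookup x∉ (∈-++⁺ʳ xs v∈ys) refl
Unique[xs++ys]⇒Disjoint (x ∷ xs) (_ ∷ u) (there v∈xs , v∈ys) =
  Unique[xs++ys]⇒Disjoint xs u (v∈xs , v∈ys)

Disjoint-anti-mono : xs′ ⊆ xs → ys′ ⊆ ys → Disjoint xs ys → Disjoint xs′ ys′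
Disjoint-anti-mono xs′⊆xs ys′⊆ys xs#ys (v∈xs′ , v∈ys′) = xs#ys (xs′⊆xs v∈xs′ , ys′⊆ys v∈ys′)

Disjoint-++ : ∀ xs {ys} xs′ {ys′} →
  Disjoint xs xs′ → Disjoint xs ys′ → Disjoint ys xs′ → Disjoint ys ys′ →
  Disjoint {A = A} (xs ++ ys) (xs′ ++ ys′)
Disjoint-++ xs xs′ xx′ xy′ yx′ yy′ (v∈l , v∈r) with ∈-++⁻ xs v∈l | ∈-++⁻ xs′ v∈r
... | inj₁ v∈x | inj₁ v∈x′ = xx′ (v∈x , v∈x′)
... | inj₁ v∈x | inj₂ v∈y′ = xy′ (v∈x , v∈y′)
... | inj₂ v∈y | inj₁ v∈x′ = yx′ (v∈y , v∈x′)
... | inj₂ v∈y | inj₂ v∈y′ = yy′ (v∈y , v∈y′)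

++-⊆ : ∀ {xs : List A} → xs ⊆ zs → ys ⊆ zs → xs ++ ys ⊆ zs
++-⊆ {xs = xs} xs⊆zs ys⊆zs v∈ = [ xs⊆zs , ys⊆zs ] (∈-++⁻ xs v∈)

∈⇒[x]⊆ : ∀ {x : A} → x ∈ xs → x ∷ [] ⊆ xs
∈⇒[x]⊆ x∈xs (here refl) = x∈xs

module _ {n : ℕ} (G : Graph n) where
  open Graph G using (adj; irrefl) renaming (sym to adj-sym)

  Adj-sym : ∀ {u v} → Adj G u v → Adj G v u
  Adj-sym {u} {v} uv = trans (adj-sym v u) uv

  Adj⇒≢ : ∀ {u v} → Adj G u v → u ≢ v
  Adj⇒≢ {u} uv refl with () ← trans (sym (irrefl u)) uv

  IsTriangle⇒Unique : ∀ {p q r} → IsTriangle G p q r → Unique (p ∷ q ∷ r ∷ [])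
  IsTriangle⇒Unique (pq , qr , pr) = (Adj⇒≢ pq ∷ Adj⇒≢ pr ∷ []) ∷ (Adj⇒≢ qr ∷ []) ∷ [] ∷ []

  χ : Fin n → Fin n → ℕ
  χ u v = if adj u v then 1 else 0

  deg : Fin n → List (Fin n) → ℕ
  deg u B = sum (map (χ u) B)

  χ≤1 : ∀ u v → χ u v ≤ 1
  χ≤1 u v with adj u v
  ... | true  = ≤-refl
  ... | false = z≤n

  χ-pair : ∀ a b t → (Adj G a t × Adj G b t) ⊎ χ a t + χ b t ≤ 1
  χ-pair a b t with adj a t | adj b t
  ... | true  | true  = inj₁ (refl , refl)
  ... | true  | false = inj₂ ≤-refl
  ... | false | true  = inj₂ ≤-refl
  ... | false | false = inj₂ z≤n

  deg≤length : ∀ u B → deg u B ≤ length B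
  deg≤length u []      = z≤n
  deg≤length u (t ∷ B) = +-mono-≤ (χ≤1 u t) (deg≤length u B)

  length≤deg⇒All-Adj : ∀ u B → length B ≤ deg u B → All (Adj G u) B
  length≤deg⇒All-Adj u []      _ = []
  length≤deg⇒All-Adj u (t ∷ B) h with adj u t in ut
  ... | true  = ut ∷ length≤deg⇒All-Adj u B (s≤s⁻¹ h)
  ... | false = contradiction (≤-trans h (deg≤length u B)) (n≮n (length B))

  edgesBetween-∷ : ∀ u A B → edgesBetween G (u ∷ A) B ≡ deg u B + edgesBetween G A B
  edgesBetween-∷ u A B = sum-++ (map (χ u) B) (concatMap (λ v → map (χ v) B) A)

  edgesBetween-++ : ∀ A A′ B →
    edgesBetween G (A ++ A′) B ≡ edgesBetween G A B + edgesBetween G A′ B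
  edgesBetween-++ []      A′ B = refl
  edgesBetween-++ (u ∷ A) A′ B = begin
    edgesBetween G (u ∷ A ++ A′) B
      ≡⟨ edgesBetween-∷ u (A ++ A′) B ⟩
    deg u B + edgesBetween G (A ++ A′) B
      ≡⟨ cong (deg u B +_) (edgesBetween-++ A A′ B) ⟩
    deg u B + (edgesBetween G A B + edgesBetween G A′ B)
      ≡⟨ sym (+-assoc (deg u B) _ _) ⟩
    (deg u B + edgesBetween G A B) + edgesBetween G A′ B
      ≡⟨ cong (_+ edgesBetween G A′ B) (sym (edgesBetween-∷ u A B)) ⟩
    edgesBetween G (u ∷ A) B + edgesBetween G A′ B
      ∎
    where open ≡-Reasoning

  edgesBetween-pair : ∀ a b B → edgesBetween G (a ∷ b ∷ []) B ≡ deg a B + deg b B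
  edgesBetween-pair a b B =
    trans (edgesBetween-∷ a (b ∷ []) B)
          (cong (deg a B +_) (trans (edgesBetween-∷ b [] B) (+-identityʳ (deg b B))))

  deg-pair-∷ : ∀ a b t B →
    deg a (t ∷ B) + deg b (t ∷ B) ≡ (χ a t + χ b t) + (deg a B + deg b B)
  deg-pair-∷ a b t B = interchange (χ a t) (deg a B) (χ b t) (deg b B)

  common-neighbour : ∀ a b B → length B < deg a B + deg b B →
    ∃[ w ] w ∈ B × Adj G a w × Adj G b w
  common-neighbour a b (t ∷ B) h with χ-pair a b t
  ... | inj₁ (at , bt) = t , here refl , at , bt
  ... | inj₂ χ≤1 =
    let w , w∈B , aw , bw = common-neighbour a b B
          (k+l≤m+n∧m≤k⇒l≤n (subst (length (t ∷ B) <_) (deg-pair-∷ a b t B) h) χ≤1)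
    in  w , there w∈B , aw , bw

  common-neighbour-≢ : ∀ a b {B} → Unique B → suc (length B) < deg a B + deg b B →
    ∀ u → ∃[ w ] w ∈ B × w ≢ u × Adj G a w × Adj G b w
  common-neighbour-≢ a b {t ∷ B} (t∉B ∷ B!) h u
    with h′ ← subst (suc (length (t ∷ B)) <_) (deg-pair-∷ a b t B) h | χ-pair a b t
  ... | inj₂ χ≤1 =
    let w , w∈B , w≢u , aw , bw = common-neighbour-≢ a b B! (k+l≤m+n∧m≤k⇒l≤n h′ χ≤1) u
    in  w , there w∈B , w≢u , aw , bw
  ... | inj₁ (at , bt) with t ≟ u
  ...   | no t≢u   = t , here refl , t≢u , at , bt
  ...   | yes refl =
    let w , w∈B , aw , bw = common-neighbour a b B
          (k+l≤m+n∧m≤k⇒l≤n h′ (+-mono-≤ (χ≤1 a t) (χ≤1 b t)))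
    in  w , there w∈B , (λ w≡t → All.lookup t∉B w∈B (sym w≡t)) , aw , bw

  two-neighbours-in-triangle : ∀ v x y z → 2 ≤ deg v (x ∷ y ∷ z ∷ []) →
    (Adj G v y × Adj G v z) ⊎ (Adj G v x × Adj G v z) ⊎ (Adj G v x × Adj G v y)
  two-neighbours-in-triangle v x y z h with adj v x | adj v y | adj v z
  ... | _     | true  | true  = inj₁ (refl , refl)
  ... | true  | false | true  = inj₂ (inj₁ (refl , refl))
  ... | true  | true  | false = inj₂ (inj₂ (refl , refl))
  ... | true  | false | false = contradiction h λ { (s≤s ()) }
  ... | false | true  | false = contradiction h λ { (s≤s ()) }
  ... | false | false | true  = contradiction h λ { (s≤s ()) }
  ... | false | false | false = contradiction h λ ()

  triangles⇒TwoDisjointTrianglesIn : ∀ {S p q r s t u} →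
    IsTriangle G p q r → IsTriangle G s t u →
    p ∷ q ∷ r ∷ [] ⊆ S → s ∷ t ∷ u ∷ [] ⊆ S → Disjoint (p ∷ q ∷ r ∷ []) (s ∷ t ∷ u ∷ []) →
    TwoDisjointTrianglesIn G S
  triangles⇒TwoDisjointTrianglesIn {p = p} {q} {r} {s} {t} {u} pqr stu pqr⊆S stu⊆S pqr#stu =
    p , q , r , s , t , u ,
    All.++⁺ (All.tabulate pqr⊆S) (All.tabulate stu⊆S) ,
    Unique.++⁺ (IsTriangle⇒Unique pqr) (IsTriangle⇒Unique stu) pqr#stu ,
    pqr , stu

module EdgesAndTriangle {n : ℕ} (G : Graph n) {S : List (Fin n)} {x y z : Fin n}
  (xyz : IsTriangle G x y z) (T⊆S : x ∷ y ∷ z ∷ [] ⊆ S)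
  {a b a′ b′ : Fin n} (ab : Adj G a b) (a′b′ : Adj G a′ b′)
  (ab#a′b′ : Disjoint (a ∷ b ∷ []) (a′ ∷ b′ ∷ []))
  (ab#T : Disjoint (a ∷ b ∷ []) (x ∷ y ∷ z ∷ []))
  (a′b′#T : Disjoint (a′ ∷ b′ ∷ []) (x ∷ y ∷ z ∷ []))
  (ab⊆S : a ∷ b ∷ [] ⊆ S) (a′b′⊆S : a′ ∷ b′ ∷ [] ⊆ S)
  where

  T : List (Fin n)
  T = x ∷ y ∷ z ∷ []

  e e′ : ℕ
  e  = deg G a T + deg G b T
  e′ = deg G a′ T + deg G b′ T

  xy : Adj G x y
  xy = xyz .proj₁
  yz : Adj G y z
  yz = xyz .proj₂ .proj₁
  xz : Adj G x z
  xz = xyz .proj₂ .proj₂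

  x∈T : x ∈ T
  x∈T = here refl
  y∈T : y ∈ T
  y∈T = there (here refl)
  z∈T : z ∈ T
  z∈T = there (there (here refl))

  e≤6 : e ≤ 6
  e≤6 = +-mono-≤ (deg≤length G a T) (deg≤length G b T)

  common-neighbours⇒TwoDisjointTrianglesIn : 5 ≤ e → 4 ≤ e′ → TwoDisjointTrianglesIn G S
  common-neighbours⇒TwoDisjointTrianglesIn 5≤e 4≤e′ =
    let w′ , w′∈T , a′w′ , b′w′ = common-neighbour G a′ b′ T 4≤e′
        w  , w∈T , w≢w′ , aw , bw =
          common-neighbour-≢ G a b (IsTriangle⇒Unique G xyz) 5≤e w′
    in  triangles⇒TwoDisjointTrianglesIn G (ab , bw , aw) (a′b′ , b′w′ , a′w′)
          (++-⊆ ab⊆S (⊆-trans (∈⇒[x]⊆ w∈T) T⊆S))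
          (++-⊆ a′b′⊆S (⊆-trans (∈⇒[x]⊆ w′∈T) T⊆S))
          (Disjoint-++ (a ∷ b ∷ []) (a′ ∷ b′ ∷ []) ab#a′b′
            (Disjoint-anti-mono ⊆-refl (∈⇒[x]⊆ w′∈T) ab#T)
            (Disjoint-anti-mono (∈⇒[x]⊆ w∈T) ⊆-refl (Disjoint.sym a′b′#T))
            (Unique[xs++ys]⇒Disjoint (w ∷ []) ((w≢w′ ∷ []) ∷ [] ∷ [])))

  complete-edge⇒TwoDisjointTrianglesIn : ∀ {v r p q} →
    v ∈ a′ ∷ b′ ∷ [] → r ∈ T → p ∈ T → q ∈ T →
    All (Adj G a) T → All (Adj G b) T → IsTriangle G r p q → Adj G v p → Adj G v q →
    TwoDisjointTrianglesIn G S
  complete-edge⇒TwoDisjointTrianglesIn {v} {r} {p} {q}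
    v∈a′b′ r∈T p∈T q∈T aT bT rpq@(_ , pq , _) vp vq =
    triangles⇒TwoDisjointTrianglesIn G (ab , All.lookup bT r∈T , All.lookup aT r∈T) (vp , pq , vq)
      (++-⊆ ab⊆S (⊆-trans r⊆T T⊆S))
      (++-⊆ (⊆-trans v⊆a′b′ a′b′⊆S) (⊆-trans pq⊆T T⊆S))
      (Disjoint-++ (a ∷ b ∷ []) (v ∷ [])
        (Disjoint-anti-mono ⊆-refl v⊆a′b′ ab#a′b′)
        (Disjoint-anti-mono ⊆-refl pq⊆T ab#T)
        (Disjoint-anti-mono r⊆T v⊆a′b′ (Disjoint.sym a′b′#T))
        (Unique[xs++ys]⇒Disjoint (r ∷ []) (IsTriangle⇒Unique G rpq)))
    where
    r⊆T : r ∷ [] ⊆ T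
    r⊆T = ∈⇒[x]⊆ r∈T
    v⊆a′b′ : v ∷ [] ⊆ a′ ∷ b′ ∷ []
    v⊆a′b′ = ∈⇒[x]⊆ v∈a′b′
    pq⊆T : p ∷ q ∷ [] ⊆ T
    pq⊆T = ∈-∷⁺ʳ p∈T (∈⇒[x]⊆ q∈T)

  light-edge⇒TwoDisjointTrianglesIn : 9 ≤ e + e′ → e′ ≤ 3 → TwoDisjointTrianglesIn G S
  light-edge⇒TwoDisjointTrianglesIn h e′≤3 =
    [ packing-at (here refl) , packing-at (there (here refl)) ]
      (pigeonhole 1 (k+l≤m+n∧m≤k⇒l≤n h e≤6))
    where
    6≤e : 6 ≤ e
    6≤e = k+l≤m+n∧m≤k⇒l≤n (subst (9 ≤_) (+-comm e e′) h) e′≤3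

    aT : All (Adj G a) T
    aT = length≤deg⇒All-Adj G a T
           (k+l≤m+n∧m≤k⇒l≤n (subst (6 ≤_) (+-comm (deg G a T) _) 6≤e) (deg≤length G b T))

    bT : All (Adj G b) T
    bT = length≤deg⇒All-Adj G b T (k+l≤m+n∧m≤k⇒l≤n 6≤e (deg≤length G a T))

    packing-at : ∀ {v} → v ∈ a′ ∷ b′ ∷ [] → 2 ≤ deg G v T → TwoDisjointTrianglesIn G S
    packing-at {v} v∈a′b′ 2≤v with two-neighbours-in-triangle G v x y z 2≤v
    ... | inj₁ (vy , vz) =
      complete-edge⇒TwoDisjointTrianglesIn v∈a′b′ x∈T y∈T z∈T aT bT xyz vy vz
    ... | inj₂ (inj₁ (vx , vz)) =
      complete-edge⇒TwoDisjointTrianglesIn v∈a′b′ y∈T x∈T z∈T aT bT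
        (Adj-sym G xy , xz , yz) vx vz
    ... | inj₂ (inj₂ (vx , vy)) =
      complete-edge⇒TwoDisjointTrianglesIn v∈a′b′ z∈T x∈T y∈T aT bT
        (Adj-sym G xz , xy , Adj-sym G yz) vx vy

module _ {n : ℕ} (G : Graph n) {S : List (Fin n)} {x y z : Fin n}
  (xyz : IsTriangle G x y z) (T⊆S : x ∷ y ∷ z ∷ [] ⊆ S)
  {a b a′ b′ : Fin n} (ab : Adj G a b) (a′b′ : Adj G a′ b′)
  (ab#a′b′ : Disjoint (a ∷ b ∷ []) (a′ ∷ b′ ∷ []))
  (ab#T : Disjoint (a ∷ b ∷ []) (x ∷ y ∷ z ∷ []))
  (a′b′#T : Disjoint (a′ ∷ b′ ∷ []) (x ∷ y ∷ z ∷ []))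
  (ab⊆S : a ∷ b ∷ [] ⊆ S) (a′b′⊆S : a′ ∷ b′ ∷ [] ⊆ S)
  where

  private
    module Forward  = EdgesAndTriangle G xyz T⊆S ab a′b′ ab#a′b′ ab#T a′b′#T ab⊆S a′b′⊆S
    module Backward = EdgesAndTriangle G xyz T⊆S a′b′ ab (Disjoint.sym ab#a′b′) a′b′#T ab#T a′b′⊆S ab⊆S
    open Forward using (e; e′)

  two-edges-and-triangle⇒TwoDisjointTrianglesIn : 9 ≤ e + e′ → TwoDisjointTrianglesIn G S
  two-edges-and-triangle⇒TwoDisjointTrianglesIn h with e ≤? 3 | e′ ≤? 3
  ... | yes e≤3 | _ =
    Backward.light-edge⇒TwoDisjointTrianglesIn (subst (9 ≤_) (+-comm e e′) h) e≤3
  ... | no  _   | yes e′≤3 = Forward.light-edge⇒TwoDisjointTrianglesIn h e′≤3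
  ... | no  e≰3 | no  e′≰3 =
    [ (λ 5≤e  → Forward.common-neighbours⇒TwoDisjointTrianglesIn 5≤e (≰⇒> e′≰3))
    , (λ 5≤e′ → Backward.common-neighbours⇒TwoDisjointTrianglesIn 5≤e′ (≰⇒> e≰3))
    ] (pigeonhole 4 h)

lemma2p5 : {n : ℕ} (G : Graph n) (a₁ b₁ a₂ b₂ x y z : Fin n) →
    IsMatching2 G a₁ b₁ a₂ b₂ →
    IsTriangle G x y z →
    Unique ((a₁ ∷ b₁ ∷ a₂ ∷ b₂ ∷ []) ++ (x ∷ y ∷ z ∷ [])) →
    edgesBetween G (a₁ ∷ b₁ ∷ a₂ ∷ b₂ ∷ []) (x ∷ y ∷ z ∷ []) ≥ 9 →
    TwoDisjointTrianglesIn G ((a₁ ∷ b₁ ∷ a₂ ∷ b₂ ∷ []) ++ (x ∷ y ∷ z ∷ []))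
lemma2p5 {n} G a₁ b₁ a₂ b₂ x y z (a₁b₁ , a₂b₂ , M!) xyz MT! h =
  two-edges-and-triangle⇒TwoDisjointTrianglesIn G xyz (xs⊆ys++xs T M) a₁b₁ a₂b₂
    (Unique[xs++ys]⇒Disjoint E₁ M!)
    (Disjoint-anti-mono (xs⊆xs++ys E₁ E₂) ⊆-refl M#T)
    (Disjoint-anti-mono (xs⊆ys++xs E₂ E₁) ⊆-refl M#T)
    (⊆-trans (xs⊆xs++ys E₁ E₂) (xs⊆xs++ys M T))
    (⊆-trans (xs⊆ys++xs E₂ E₁) (xs⊆xs++ys M T))
    (subst (9 ≤_) edges-split h)
  where
  E₁ E₂ M T : List (Fin n)
  E₁ = a₁ ∷ b₁ ∷ []
  E₂ = a₂ ∷ b₂ ∷ []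
  M  = E₁ ++ E₂
  T  = x ∷ y ∷ z ∷ []

  M#T : Disjoint M T
  M#T = Unique[xs++ys]⇒Disjoint M MT!

  edges-split : edgesBetween G M T ≡ (deg G a₁ T + deg G b₁ T) + (deg G a₂ T + deg G b₂ T)
  edges-split = trans (edgesBetween-++ G E₁ E₂ T)
                      (cong₂ _+_ (edgesBetween-pair G a₁ b₁ T) (edgesBetween-pair G a₂ b₂ T))
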